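{- Let $G$ and $H$ be finite, simple, connected graphs, each of order at least two. Then $\zeta(G \square H) \geq 2$.
   Context: The localization game on a connected graph $G$ is played by a Cop controlling $k$ cops and a Robber. The Robber first chooses a vertex $r$, unknown to the Cop. In each turn the Cop probes a set $B=\{b_1,\dots,b_k\}$ of $k$ vertices and receives the distance vector $[d_G(r,b_1),\dots,d_G(r,b_k)]$. If the Cop can determine $r$ exactly, the Cop wins; otherwise the Robber may stay at $r$ or move to a neighbour of $r$, and the next turn begins. The Cop wins if the Robber is located after finitely many turns. The localization number $\zeta(G)$ is the least positive integer $k$ such that the Cop has a winning strategy with $k$ cops. $G\square H$ is the Cartesian product: vertex set $V(G)\times V(H)$, $(u,u')\sim(v,v')$ iff either $u=v$ and $u'v'\in E(H)$, or $u'=v'$ and $uv\in E(G)$. -}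

module Defs where

open import Data.Nat using (ℕ; zero; suc; _≤_)
open import Data.Fin using (Fin)
open import Data.Product using (_×_; _,_; ∃)
open import Data.Sum using (_⊎_)
open import Data.Unit using (⊤)
open import Relation.Nullary using (¬_; Dec)
open import Relation.Binary.PropositionalEquality using (_≡_)

record Graph : Set₁ where
  field
    n      : ℕ
    Adj    : Fin n → Fin n → Set
    Adj?   : ∀ u v → Dec (Adj u v)
    sym    : ∀ {u v} → Adj u v → Adj v u
    irrefl : ∀ {u} → ¬ Adj u u
open Graph public

data Walk {V : Set} (E : V → V → Set) : V → V → ℕ → Set where
  here : ∀ {u} → Walk E u u 0
  step : ∀ {u v w ℓ} → E u v → Walk E v w ℓ → Walk E u w (suc ℓ)

IsDist : {V : Set} (E : V → V → Set) → V → V → ℕ → Set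
IsDist E u v d = Walk E u v d × (∀ m → Walk E u v m → d ≤ m)

Connected : Graph → Set
Connected G = ∀ u v → ∃ λ ℓ → Walk (Adj G) u v ℓ

□Adj : (G H : Graph) → Fin (n G) × Fin (n H) → Fin (n G) × Fin (n H) → Set
□Adj G H (u , u') (v , v') = (u ≡ v × Adj H u' v') ⊎ (u' ≡ v' × Adj G u v)

SameResponse : {V : Set} (E : V → V → Set) {k : ℕ} → (Fin k → V) → V → V → Set
SameResponse E {k} B x r = ∀ (i : Fin k) → ∃ λ d → IsDist E x (B i) d × IsDist E r (B i) d

-- CopWinsFrom E k S : the Cop with k cops has a winning strategy (finitely many turns)
-- when S is the set of vertices the Robber may currently occupy, consistent with all
-- information so far.  In a turn the Cop probes B; for the actual robber position r ∈ S,
-- the Cop learns the class of r (vertices of S with the same distance vector).  If that class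
-- is {r}, the Robber is located; otherwise the Robber may stay or move to a neighbour, so the
-- new candidate set is the closed neighbourhood of the class.
data CopWinsFrom {V : Set} (E : V → V → Set) (k : ℕ) : (V → Set) → Set₁ where
  probe : ∀ {S : V → Set} (B : Fin k → V) →
          (∀ r → S r →
             (∀ x → S x → SameResponse E B x r → x ≡ r)
             ⊎ CopWinsFrom E k (λ y → ∃ λ x → (S x × SameResponse E B x r) × (x ≡ y ⊎ E x y))) →
          CopWinsFrom E k S

CopWins : {V : Set} (E : V → V → Set) → ℕ → Set₁
CopWins E k = CopWinsFrom E k (λ _ → ⊤)

-- A single cop probing b sees d(x, b), which changes by at most one along each edge.  On a
-- 4-cycle these four values therefore cannot be pairwise distinct: two corners of the cycle
-- answer alike.  Take an edge u₁v₁ of G and an edge u₂v₂ of H; their product is a 4-cycle, and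
-- any two distinct corners of it have closed neighbourhoods covering the whole cycle.  So if the
-- Robber sits on one of two corners that receive the same answer, the Cop cannot locate him, and
-- whatever he does next the candidate set again contains the entire 4-cycle.
module Submission where

open import Defs
open import Data.Bool using (Bool; true; false; not; if_then_else_)
open import Data.Bool.Properties using (not-¬; ¬-not) renaming (_≟_ to _≟ᵇ_)
open import Data.Empty using (⊥-elim)
open import Data.Fin using (Fin) renaming (zero to fzero; suc to fsuc)
open import Data.Fin.Properties using (any?) renaming (_≟_ to _≟ᶠ_)
open import Data.Nat using (ℕ; zero; suc; _+_; _≤_; z≤n; s≤s)
open import Data.Nat.Properties using (<-cmp; ≤-antisym)
open import Data.Product using (_×_; _,_; ∃; ∃₂; proj₁; proj₂)
open import Data.Product.Properties using (≡-dec)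
open import Data.Sum using (_⊎_; inj₁; inj₂)
open import Data.Unit using (tt)
open import Function using (_∘_)
open import Relation.Binary using (tri<; tri≈; tri>; DecidableEquality)
open import Relation.Nullary using (¬_; Dec; yes; no)
open import Relation.Nullary.Decidable using (map′; _×-dec_; _⊎-dec_)
open import Relation.Binary.PropositionalEquality
  using (_≡_; _≢_; refl; trans; cong; cong₂; subst)
  renaming (sym to ≡-sym)
import Relation.Unary as U

least-witness : {P : ℕ → Set} → U.Decidable P → ∀ {ℓ} → P ℓ →
                ∃ λ m → P m × (∀ k → P k → m ≤ k)
least-witness P? p with P? 0
... | yes p₀ = 0 , p₀ , λ _ _ → z≤n
least-witness P? {zero} p | no ¬p₀ = ⊥-elim (¬p₀ p)
least-witness P? {suc ℓ} p | no ¬p₀ with least-witness (P? ∘ suc) p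
... | m , pm , minimal = suc m , pm , λ
  { zero p₀ → ⊥-elim (¬p₀ p₀)
  ; (suc k) pk → s≤s (minimal k pk) }

data OffByOne : ℕ → ℕ → Set where
  up   : ∀ {a} → OffByOne a (suc a)
  down : ∀ {a} → OffByOne (suc a) a

Close : ℕ → ℕ → Set
Close a b = a ≡ b ⊎ OffByOne a b

≤-suc-both⇒Close : ∀ {a b} → a ≤ suc b → b ≤ suc a → Close a b
≤-suc-both⇒Close {a} {b} a≤1+b b≤1+a with <-cmp a b
... | tri< a<b _ _ rewrite ≤-antisym b≤1+a a<b = inj₂ up
... | tri≈ _ a≡b _ = inj₁ a≡b
... | tri> _ _ b<a rewrite ≤-antisym a≤1+b b<a = inj₂ down

-- Two steps up must be followed by two steps down and vice versa.
OffByOne-4-cycle : ∀ {a b c d} → OffByOne a b → OffByOne b c → OffByOne c d → OffByOne d a →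
                   a ≡ c ⊎ b ≡ d
OffByOne-4-cycle up   down _    _  = inj₁ refl
OffByOne-4-cycle down up   _    _  = inj₁ refl
OffByOne-4-cycle up   up   down _  = inj₂ refl
OffByOne-4-cycle up   up   up   ()
OffByOne-4-cycle down down up   _  = inj₂ refl
OffByOne-4-cycle down down down ()

Corner : Set
Corner = Bool × Bool

Close-square-collision : (f : Corner → ℕ) →
  Close (f (false , false)) (f (true , false)) → Close (f (true , false)) (f (true , true)) →
  Close (f (true , true)) (f (false , true)) → Close (f (false , true)) (f (false , false)) →
  ∃₂ λ σ τ → σ ≢ τ × f σ ≡ f τ
Close-square-collision f (inj₁ e) _ _ _ = (false , false) , (true , false) , (λ ()) , e
Close-square-collision f _ (inj₁ e) _ _ = (true , false) , (true , true) , (λ ()) , e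
Close-square-collision f _ _ (inj₁ e) _ = (true , true) , (false , true) , (λ ()) , e
Close-square-collision f _ _ _ (inj₁ e) = (false , true) , (false , false) , (λ ()) , e
Close-square-collision f (inj₂ s₁) (inj₂ s₂) (inj₂ s₃) (inj₂ s₄) with OffByOne-4-cycle s₁ s₂ s₃ s₄
... | inj₁ e = (false , false) , (true , true) , (λ ()) , e
... | inj₂ e = (true , false) , (false , true) , (λ ()) , e

module _ {V : Set} {E : V → V → Set} where

  _++ʷ_ : ∀ {u v w l m} → Walk E u v l → Walk E v w m → Walk E u w (l + m)
  here     ++ʷ q = q
  step e p ++ʷ q = step e (p ++ʷ q)

  walk-leaves : ∀ {u v ℓ} → Walk E u v ℓ → u ≢ v → ∃ (E u)
  walk-leaves here       u≢v = ⊥-elim (u≢v refl)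
  walk-leaves (step e _) _   = _ , e

  map-walk : {W : Set} {F : W → W → Set} (f : V → W) → (∀ {x y} → E x y → F (f x) (f y)) →
             ∀ {u v ℓ} → Walk E u v ℓ → Walk F (f u) (f v) ℓ
  map-walk f hom here       = here
  map-walk f hom (step e p) = step (hom e) (map-walk f hom p)

  IsDist-step : ∀ {x y b dx dy} → E x y → IsDist E x b dx → IsDist E y b dy → dx ≤ suc dy
  IsDist-step e (_ , minimal) (walk , _) = minimal _ (step e walk)

  IsDist-Close : (∀ {x y} → E x y → E y x) → ∀ {x y b dx dy} → E x y →
                 IsDist E x b dx → IsDist E y b dy → Close dx dy
  IsDist-Close E-sym e dx dy = ≤-suc-both⇒Close (IsDist-step e dx dy) (IsDist-step (E-sym e) dy dx)

  module ShortestWalk (_≟_ : DecidableEquality V)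
                      (∃? : {P : V → Set} → U.Decidable P → Dec (∃ P))
                      (E? : ∀ x y → Dec (E x y)) where

    walk? : ∀ ℓ u v → Dec (Walk E u v ℓ)
    walk? zero    u v = map′ (λ { refl → here }) (λ { here → refl }) (u ≟ v)
    walk? (suc ℓ) u v = map′ (λ (w , e , p) → step e p) (λ { (step e p) → _ , e , p })
                             (∃? (λ w → E? u w ×-dec walk? ℓ w v))

    IsDist-exists : ∀ {u v ℓ} → Walk E u v ℓ → ∃ (IsDist E u v)
    IsDist-exists {u} {v} = least-witness (λ m → walk? m u v)

  Next : ∀ {k} → (V → Set) → (Fin k → V) → V → V → Set
  Next S B r y = ∃ λ x → (S x × SameResponse E B x r) × (x ≡ y ⊎ E x y)

  SameResponse-refl : ∀ {k} (B : Fin k → V) → (∀ x y → ∃ (IsDist E x y)) → ∀ x →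
                      SameResponse E B x x
  SameResponse-refl B dist x i = let (d , p) = dist x (B i) in d , p , p

  -- Safe S: from candidate set S the Robber has a move keeping the Cop uncertain.
  robber-evades : ∀ {k} (Safe : (V → Set) → Set) →
    (∀ {S} (B : Fin k → V) → Safe S →
       ∃₂ λ r x → S r × S x × x ≢ r × SameResponse E B x r × Safe (Next S B r)) →
    ∀ {S} → Safe S → ¬ CopWinsFrom E k S
  robber-evades Safe escape safe (probe B strategy) with escape B safe
  ... | r , x , Sr , Sx , x≢r , x~r , safe′ with strategy r Sr
  ...   | inj₁ located = x≢r (located x Sx x~r)
  ...   | inj₂ continue = robber-evades Safe escape safe′ continue

edge-exists : (G : Graph) → Connected G → 2 ≤ n G → ∃₂ (Adj G)
edge-exists G connected (s≤s (s≤s _)) =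
  fzero , walk-leaves (proj₂ (connected fzero (fsuc fzero))) λ ()

choose : {A : Set} → Bool → A → A → A
choose i a b = if i then b else a

choose-injective : {A : Set} {a b : A} → a ≢ b → ∀ {i j} → choose i a b ≡ choose j a b → i ≡ j
choose-injective a≢b {false} {false} _ = refl
choose-injective a≢b {false} {true}  e = ⊥-elim (a≢b e)
choose-injective a≢b {true}  {false} e = ⊥-elim (a≢b (≡-sym e))
choose-injective a≢b {true}  {true}  _ = refl

choose-adj : (G : Graph) → ∀ {a b} → Adj G a b → ∀ {i j} → i ≢ j →
             Adj G (choose i a b) (choose j a b)
choose-adj G e {false} {false} i≢j = ⊥-elim (i≢j refl)
choose-adj G e {false} {true}  _   = e
choose-adj G e {true}  {false} _   = Graph.sym G e
choose-adj G e {true}  {true}  i≢j = ⊥-elim (i≢j refl)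

module Product (G H : Graph) where

  V : Set
  V = Fin (n G) × Fin (n H)

  E : V → V → Set
  E = □Adj G H

  E-sym : ∀ {x y} → E x y → E y x
  E-sym (inj₁ (refl , a)) = inj₁ (refl , Graph.sym H a)
  E-sym (inj₂ (refl , a)) = inj₂ (refl , Graph.sym G a)

  walk-exists : Connected G → Connected H → ∀ x y → ∃ (Walk E x y)
  walk-exists cG cH (g , h) (g′ , h′) =
    _ , map-walk (_, h) (λ a → inj₂ (refl , a)) (proj₂ (cG g g′))
     ++ʷ map-walk (g′ ,_) (λ a → inj₁ (refl , a)) (proj₂ (cH h h′))

  open ShortestWalk {E = E} (≡-dec _≟ᶠ_ _≟ᶠ_)
    (λ P? → map′ (λ (i , j , p) → (i , j) , p) (λ ((i , j) , p) → i , j , p)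
                 (any? λ i → any? λ j → P? (i , j)))
    (λ (a , b) (c , d) → ((a ≟ᶠ c) ×-dec Adj? H b d) ⊎-dec ((b ≟ᶠ d) ×-dec Adj? G a c))

  dist-exists : Connected G → Connected H → ∀ x y → ∃ (IsDist E x y)
  dist-exists cG cH x y = IsDist-exists (proj₂ (walk-exists cG cH x y))

  module Square {u₁ v₁ u₂ v₂} (e₁ : Adj G u₁ v₁) (e₂ : Adj H u₂ v₂) where

    corner : Corner → V
    corner (i , j) = choose i u₁ v₁ , choose j u₂ v₂

    corner-injective : ∀ {σ τ} → corner σ ≡ corner τ → σ ≡ τ
    corner-injective e =
      cong₂ _,_ (choose-injective (λ { refl → Graph.irrefl G e₁ }) (cong proj₁ e))
                (choose-injective (λ { refl → Graph.irrefl H e₂ }) (cong proj₂ e))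

    flip₁-adj : ∀ i j → E (corner (i , j)) (corner (not i , j))
    flip₁-adj i j = inj₂ (refl , choose-adj G e₁ (not-¬ refl))

    flip₂-adj : ∀ i j → E (corner (i , j)) (corner (i , not j))
    flip₂-adj i j = inj₁ (refl , choose-adj H e₂ (not-¬ refl))

    -- Every corner shares a coordinate with one of two distinct corners, and corners sharing a
    -- coordinate are equal or adjacent.
    corner-cover : ∀ {σ τ} → σ ≢ τ → ∀ ρ →
                   (corner σ ≡ corner ρ ⊎ E (corner σ) (corner ρ))
                   ⊎ (corner τ ≡ corner ρ ⊎ E (corner τ) (corner ρ))
    corner-cover {i , j} {i′ , j′} σ≢τ (k , l) with i ≟ᵇ k | j ≟ᵇ l | i′ ≟ᵇ k | j′ ≟ᵇ l
    ... | yes refl | yes refl | _        | _        = inj₁ (inj₁ refl)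
    ... | yes refl | no j≢l   | _        | _        =
      inj₁ (inj₂ (inj₁ (refl , choose-adj H e₂ j≢l)))
    ... | no i≢k   | yes refl | _        | _        =
      inj₁ (inj₂ (inj₂ (refl , choose-adj G e₁ i≢k)))
    ... | no i≢k   | no j≢l   | yes refl | yes refl = inj₂ (inj₁ refl)
    ... | no i≢k   | no j≢l   | yes refl | no j′≢l  =
      inj₂ (inj₂ (inj₁ (refl , choose-adj H e₂ j′≢l)))
    ... | no i≢k   | no j≢l   | no i′≢k  | yes refl =
      inj₂ (inj₂ (inj₂ (refl , choose-adj G e₁ i′≢k)))
    ... | no i≢k   | no j≢l   | no i′≢k  | no j′≢l  =
      ⊥-elim (σ≢τ (cong₂ _,_ (trans (¬-not i≢k) (≡-sym (¬-not i′≢k)))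
                             (trans (¬-not j≢l) (≡-sym (¬-not j′≢l)))))

    SquareIn : (V → Set) → Set
    SquareIn S = ∀ σ → S (corner σ)

    one-cop-loses : Connected G → Connected H → ∀ {S} → SquareIn S → ¬ CopWinsFrom E 1 S
    one-cop-loses cG cH = robber-evades SquareIn escape
      where
      dist : ∀ x y → ∃ (IsDist E x y)
      dist = dist-exists cG cH

      distance-to : V → Corner → ℕ
      distance-to b σ = proj₁ (dist (corner σ) b)

      close : ∀ b {σ τ} → E (corner σ) (corner τ) → Close (distance-to b σ) (distance-to b τ)
      close b e = IsDist-Close E-sym e (proj₂ (dist _ b)) (proj₂ (dist _ b))

      escape : ∀ {S} (B : Fin 1 → V) → SquareIn S →
               ∃₂ λ r x → S r × S x × x ≢ r × SameResponse E B x r × SquareIn (Next S B r)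
      escape {S} B square
        with Close-square-collision (distance-to (B fzero))
               (close _ (flip₁-adj false false)) (close _ (flip₂-adj true false))
               (close _ (flip₁-adj true true)) (close _ (flip₂-adj false true))
      ... | σ , τ , σ≢τ , dσ≡dτ =
        corner σ , corner τ , square σ , square τ , (λ e → σ≢τ (≡-sym (corner-injective e))) ,
        τ~σ , next
        where
        τ~σ : SameResponse E B (corner τ) (corner σ)
        τ~σ fzero = _ , proj₂ (dist (corner τ) (B fzero)) ,
                    subst (IsDist E (corner σ) (B fzero)) dσ≡dτ (proj₂ (dist (corner σ) (B fzero)))

        next : SquareIn (Next S B (corner σ))
        next ρ with corner-cover σ≢τ ρ
        ... | inj₁ near-σ = corner σ , (square σ , SameResponse-refl B dist (corner σ)) , near-σ
        ... | inj₂ near-τ = corner τ , (square τ , τ~σ) , near-τ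

proposition3p2 : (G H : Graph) → Connected G → Connected H → 2 ≤ n G → 2 ≤ n H →
    ∀ k → 1 ≤ k → CopWins (□Adj G H) k → 2 ≤ k
proposition3p2 G H cG cH 2≤|G| 2≤|H| zero () _
proposition3p2 G H cG cH 2≤|G| 2≤|H| (suc (suc _)) _ _ = s≤s (s≤s z≤n)
proposition3p2 G H cG cH 2≤|G| 2≤|H| 1 _ wins
  with edge-exists G cG 2≤|G| | edge-exists H cH 2≤|H|
... | u₁ , v₁ , e₁ | u₂ , v₂ , e₂ =
  ⊥-elim (Product.Square.one-cop-loses G H e₁ e₂ cG cH (λ _ → tt) wins)
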